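{- Let $(U,\mathcal{D})$ be a tight interdependent orbit union with $\mathcal{D}=\{D_1,\ldots,D_m\}$, $m\geq 3$, and let $3\leq n\leq m$ and $s\leq n-1$ be such that $\{D_1,\ldots,D_{n-1}\}$ is the vertex set of a connected component of the graph $\mathcal{O}(U,\mathcal{D})-D_n$ and the frames among $D_1,\ldots,D_{n-1}$ adjacent to $D_n$ in $\mathcal{O}(U,\mathcal{D})$ are exactly $D_s,\ldots,D_{n-1}$. Let $U_n$, $\Phi_n$ and $Q$ be as in the context, let $G^*$ be a subgroup of $\mathrm{Aut}_{\mathcal{D}}(U)$, and let $H=\{\Psi\in G^*:\Psi_n=\mathrm{id}_{U_n}\}$. Then $H$ is a normal subgroup of $G^*$, the factor group $G^*/H$ is isomorphic to the group $\{\Phi_n:\Phi\in G^*\}$, and consequently $$|G^*|=\left|\{\Phi_n:\Phi\in G^*\}\right|\cdot\left|\{\Psi|_Q:\Psi\in H\}\right|.$$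
   Context: All ordered sets are finite; $x\sim y$ means $x,y$ are comparable. A nonempty $A\subseteq P$ is order-autonomous if for every $z\in P\setminus A$: $z<a$ for some $a\in A$ implies $z<A$ (below all of $A$), and $z>a$ for some $a\in A$ implies $z>A$; nontrivial means $|A|\notin\{1,|P|\}$. A structured ordered set $(P,\mathcal{D})$ is an ordered set with a partition $\mathcal{D}$ of $P$ into antichains (frames); $\mathrm{Aut}_{\mathcal{D}}(P)$ is the group of automorphisms $\Phi$ with $\Phi[D]=D$ for all $D\in\mathcal{D}$, whose orbits are the $\mathcal{D}$-orbits. Distinct $\mathcal{D}$-orbits $C,E$ are directly interdependent if some $c\in C$, $e\in E$ satisfy $c<e$ or $e<c$ and some $c'\in C,e'\in E$ are incomparable. The orbit graph $\mathcal{O}(P,\mathcal{D})$ has the $\mathcal{D}$-orbits as vertices, adjacent iff directly interdependent. $(P,\mathcal{D})$ is an interdependent orbit union if its orbit graph is connected, and tight if each frame is one $\mathcal{D}$-orbit and no frame contains a nontrivial order-autonomous antichain of $P$. Construction: let $W=U\setminus(D_n\cup\cdots\cup D_m)$ with induced order. For $j\in\{s,\ldots,n-1\}$ let $A^j_1,\ldots,A^j_{\ell_j}$ be the maximal subsets of $D_j$ that are order-autonomous antichains in $W$; they partition $D_j$, and every $\Phi\in\mathrm{Aut}_{\mathcal{D}}(U)$ maps each $A^j_i$ onto some $A^j_k$. Fix $a^j_i\in A^j_i$ and put $U_n=D_1\cup\cdots\cup D_{s-1}\cup\{a^j_i: s\leq j\leq n-1, 1\leq i\leq \ell_j\}$.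 For $\Phi\in\mathrm{Aut}_{\mathcal{D}}(U)$, $\Phi_n:U_n\to U_n$ agrees with $\Phi$ on $D_1\cup\cdots\cup D_{s-1}$ and maps $a^j_i$ to the unique element of $\Phi[A^j_i]\cap U_n$. Finally $Q=D_s\cup\cdots\cup D_m$. -}

module Defs where

open import Data.Nat using (ℕ; _≤_; _<_; _<?_; _∸_)
open import Data.Fin using (Fin)
open import Data.Fin.Subset using (Subset; _∈_; _∉_; _⊆_; ∣_∣)
open import Data.Fin.Permutation using (Permutation′; _⟨$⟩ʳ_; _≈_)
open import Data.Product using (Σ; ∃; ∃-syntax; _×_; _,_)
open import Data.Sum using (_⊎_)
open import Data.Unit using (⊤)
open import Relation.Nullary using (¬_; yes; no)
open import Relation.Binary.PropositionalEquality using (_≡_; _≢_)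
open import Relation.Binary.Structures using (IsPartialOrder)
open import Relation.Binary.Construct.Closure.ReflexiveTransitive using (Star)
open import Function.Bundles using (_⇔_)

-- Frames are indexed 1..m as in the paper: x ∈ D_k  iff  frame x ≡ k.

record SOS : Set₁ where
  field
    N      : ℕ
    m      : ℕ
    _⊑_    : Fin N → Fin N → Set
    isPO   : IsPartialOrder _≡_ _⊑_
    frame  : Fin N → ℕ
    frame-range    : ∀ x → 1 ≤ frame x × frame x ≤ m
    frame-nonempty : ∀ k → 1 ≤ k → k ≤ m → ∃[ x ] frame x ≡ k
    frame-antichain : ∀ x y → frame x ≡ frame y → x ⊑ y → x ≡ y

module _ (S : SOS) where
  open SOS S

  _⊏_ : Fin N → Fin N → Set
  x ⊏ y = x ⊑ y × x ≢ y

  Comparable : Fin N → Fin N → Set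
  Comparable x y = x ⊏ y ⊎ y ⊏ x

  Antichain : Subset N → Set
  Antichain A = ∀ x y → x ∈ A → y ∈ A → ¬ (x ⊏ y)

  OrderAutonomousIn : (Fin N → Set) → Subset N → Set
  OrderAutonomousIn W A =
    (∃[ a ] a ∈ A) ×
    (∀ a → a ∈ A → W a) ×
    (∀ z → W z → z ∉ A →
       ((∃[ a ] (a ∈ A × z ⊏ a)) → ∀ a → a ∈ A → z ⊏ a) ×
       ((∃[ a ] (a ∈ A × a ⊏ z)) → ∀ a → a ∈ A → a ⊏ z))

  OrderAutonomous : Subset N → Set
  OrderAutonomous = OrderAutonomousIn (λ _ → ⊤)

  IsAutD : Permutation′ N → Set
  IsAutD π = (∀ x y → (x ⊑ y) ⇔ ((π ⟨$⟩ʳ x) ⊑ (π ⟨$⟩ʳ y)))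
           × (∀ x → frame (π ⟨$⟩ʳ x) ≡ frame x)

  SameOrbit : Fin N → Fin N → Set
  SameOrbit x y = Σ (Permutation′ N) λ π → IsAutD π × π ⟨$⟩ʳ x ≡ y

  OrbitsDirectlyInterdependent : Fin N → Fin N → Set
  OrbitsDirectlyInterdependent x y =
    ¬ SameOrbit x y ×
    (∃[ c ] ∃[ e ] (SameOrbit x c × SameOrbit y e × Comparable c e)) ×
    (∃[ c ] ∃[ e ] (SameOrbit x c × SameOrbit y e × ¬ Comparable c e))

  -- the orbit graph O(P,D) is connected: any two orbits (represented by
  -- any of their elements) are joined by a walk in the orbit graph
  -- (steps inside one orbit do not move in the orbit graph)
  InterdependentOrbitUnion : Set
  InterdependentOrbitUnion =
    ∀ x y → Star (λ a b → SameOrbit a b ⊎ OrbitsDirectlyInterdependent a b) x y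

  Tight : Set
  Tight =
    (∀ x y → frame x ≡ frame y → SameOrbit x y) ×
    (∀ (k : ℕ) (A : Subset N) → (∀ a → a ∈ A → frame a ≡ k) →
       OrderAutonomous A → Antichain A → ∣ A ∣ ≡ 1 ⊎ ∣ A ∣ ≡ N)

  -- adjacency of frames D_k, D_l in the orbit graph (for tight structured
  -- ordered sets the D-orbits are exactly the frames)
  FrameAdj : ℕ → ℕ → Set
  FrameAdj k l =
    k ≢ l ×
    (∃[ c ] ∃[ e ] (frame c ≡ k × frame e ≡ l × Comparable c e)) ×
    (∃[ c ] ∃[ e ] (frame c ≡ k × frame e ≡ l × ¬ Comparable c e))

  FrameAdjAvoiding : ℕ → ℕ → ℕ → Set
  FrameAdjAvoiding n k l = FrameAdj k l × k ≢ n × l ≢ n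

  IsComponentBelow : ℕ → Set
  IsComponentBelow n =
    (∀ k l → 1 ≤ k → k ≤ n ∸ 1 → 1 ≤ l → l ≤ n ∸ 1 → Star (FrameAdjAvoiding n) k l) ×
    (∀ k l → 1 ≤ k → k ≤ n ∸ 1 → FrameAdj k l → l ≢ n → l ≤ n ∸ 1)

  NeighboursOf : ℕ → ℕ → Set
  NeighboursOf n s = ∀ k → 1 ≤ k → k ≤ n ∸ 1 → (FrameAdj k n ⇔ (s ≤ k))

  W : ℕ → Fin N → Set
  W n x = frame x < n

  MaxBlock : ℕ → ℕ → Subset N → Set
  MaxBlock n j A =
    (∀ a → a ∈ A → frame a ≡ j) × OrderAutonomousIn (W n) A × Antichain A ×
    (∀ B → A ⊆ B → (∀ b → b ∈ B → frame b ≡ j) →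
       OrderAutonomousIn (W n) B → Antichain B → B ⊆ A)

  SameBlock : ℕ → Fin N → Fin N → Set
  SameBlock n x y = Σ (Subset N) λ A → MaxBlock n (frame x) A × x ∈ A × y ∈ A

  InRange : ℕ → ℕ → Fin N → Set
  InRange n s x = s ≤ frame x × frame x ≤ n ∸ 1

  -- rep assigns to each x ∈ D_j (s ≤ j ≤ n-1) the fixed element a^j_i of
  -- the block A^j_i containing x
  IsRepChoice : ℕ → ℕ → (Fin N → Fin N) → Set
  IsRepChoice n s rep =
    (∀ x → InRange n s x → SameBlock n x (rep x)) ×
    (∀ x y → InRange n s x → InRange n s y → SameBlock n x y → rep x ≡ rep y)

  Un : ℕ → ℕ → (Fin N → Fin N) → Fin N → Set
  Un n s rep x = frame x < s ⊎ (InRange n s x × rep x ≡ x)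

  -- Φ_n (only meaningful on U_n)
  restrictN : ℕ → (Fin N → Fin N) → Permutation′ N → Fin N → Fin N
  restrictN s rep Φ x with frame x <? s
  ... | yes _ = Φ ⟨$⟩ʳ x
  ... | no _  = rep (Φ ⟨$⟩ʳ x)

  Q : ℕ → Fin N → Set
  Q s x = s ≤ frame x

EqOn : ∀ {n} → (Fin n → Set) → (Fin n → Fin n) → (Fin n → Fin n) → Set
EqOn P f g = ∀ x → P x → f x ≡ g x

-- the collection {a : A | P a}, considered up to the equivalence _~_,
-- has exactly k elements
HasCard : {A : Set} → (A → Set) → (A → A → Set) → ℕ → Set
HasCard {A} P _~_ k =
  Σ (Fin k → A) λ e →
    (∀ i → P (e i)) ×
    (∀ i j → e i ~ e j → i ≡ j) ×
    (∀ a → P a → ∃[ i ] (e i ~ a))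

IsSubgroupAutD : (S : SOS) → (Permutation′ (SOS.N S) → Set) → Set
IsSubgroupAutD S G =
  (∀ π ρ → π ≈ ρ → G π → G ρ) ×
  (∀ π → G π → IsAutD S π) ×
  G Data.Fin.Permutation.id ×
  (∀ π ρ → G π → G ρ → G (π Data.Fin.Permutation.∘ₚ ρ)) ×
  (∀ π → G π → G (Data.Fin.Permutation.flip π))

{-# OPTIONS --safe #-}
-- Automorphisms in Aut_D(U) permute the blocks A^j_i, so Φ ↦ Φ_n is a
-- homomorphism from G* into the permutations of U_n, and H is its
-- kernel; the cosets of H in G* therefore correspond to the maps Φ_n.  An
-- element of H fixes D_1 ∪ … ∪ D_{s-1} pointwise, so it is determined by
-- its restriction to Q, and counting G* as (coset, element of H) pairs
-- gives |G*| = |{Φ_n}| · |{Ψ|_Q}|.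
module Submission where

open import Defs
open import Data.Nat using (ℕ; _≤_; _<_; _<?_; _*_; _∸_)
open import Data.Nat.Properties using (≮⇒≥; <⇒≱)
open import Data.Fin using (Fin)
open import Data.Fin.Properties using (cantor-schröder-bernstein; *↔×)
open import Data.Fin.Subset using (Subset; _∈_; _∉_; _⊆_)
open import Data.Fin.Permutation
  using (Permutation′; _⟨$⟩ʳ_; _⟨$⟩ˡ_; _≈_; _∘ₚ_; flip; inverseˡ; inverseʳ)
import Data.Fin.Permutation as Perm
open import Data.Vec using (tabulate; lookup)
open import Data.Vec.Properties using (lookup∘tabulate; []=⇒lookup; lookup⇒[]=)
open import Data.Product using (Σ; ∃-syntax; _×_; _,_; proj₁; proj₂)
open import Data.Product.Properties using (,-injective)
open import Data.Sum using (inj₁; inj₂)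
open import Function.Base using (id)
open import Function.Bundles using (_⇔_; Equivalence; mk⇔; _↣_; mk↣; Injection)
open import Function.Construct.Composition using (_↣-∘_)
open import Function.Construct.Symmetry using (↔-sym)
open import Function.Properties.Inverse using (↔⇒↣)
open import Relation.Nullary using (yes; no; contradiction)
open import Relation.Binary.PropositionalEquality
  using (_≡_; refl; sym; trans; cong; cong₂; subst; subst₂; module ≡-Reasoning)

open ≡-Reasoning

-- Finite sets and permutations

≡-*-if-↣-both-ways : ∀ {a b c} →
  Fin a ↣ (Fin b × Fin c) → (Fin b × Fin c) ↣ Fin a → a ≡ b * c
≡-*-if-↣-both-ways f g = cantor-schröder-bernstein
  (Injection.injective (↔⇒↣ (↔-sym *↔×) ↣-∘ f))
  (Injection.injective (g ↣-∘ ↔⇒↣ *↔×))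

∘ₚ-cancelʳ : ∀ {k} (π ρ σ : Permutation′ k) → π ∘ₚ σ ≈ ρ ∘ₚ σ → π ≈ ρ
∘ₚ-cancelʳ π ρ σ e x = begin
  π ⟨$⟩ʳ x                        ≡⟨ inverseˡ σ ⟨
  σ ⟨$⟩ˡ (σ ⟨$⟩ʳ (π ⟨$⟩ʳ x))      ≡⟨ cong (σ ⟨$⟩ˡ_) (e x) ⟩
  σ ⟨$⟩ˡ (σ ⟨$⟩ʳ (ρ ⟨$⟩ʳ x))      ≡⟨ inverseˡ σ ⟩
  ρ ⟨$⟩ʳ x                        ∎

module _ {k : ℕ} where

  image : Permutation′ k → Subset k → Subset k
  image π A = tabulate (λ y → lookup A (π ⟨$⟩ˡ y))

  ∈-image⁻ : ∀ π A {y} → y ∈ image π A → π ⟨$⟩ˡ y ∈ A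
  ∈-image⁻ π A {y} y∈ =
    lookup⇒[]= _ A (trans (sym (lookup∘tabulate _ y)) ([]=⇒lookup y∈))

  ∈-image⁺ : ∀ π A {y} → π ⟨$⟩ˡ y ∈ A → y ∈ image π A
  ∈-image⁺ π A {y} y∈ =
    lookup⇒[]= y _ (trans (lookup∘tabulate _ y) ([]=⇒lookup y∈))

  ∈-image : ∀ π A {a} → a ∈ A → π ⟨$⟩ʳ a ∈ image π A
  ∈-image π A a∈ = ∈-image⁺ π A (subst (_∈ A) (sym (inverseˡ π)) a∈)

module Enumeration {A : Set} {P : A → Set} {_~_ : A → A → Set} {k : ℕ}
                   (card : HasCard P _~_ k) where

  enum : Fin k → A
  enum = proj₁ card

  enum-valid : ∀ i → P (enum i)
  enum-valid = proj₁ (proj₂ card)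

  enum-injective : ∀ i j → enum i ~ enum j → i ≡ j
  enum-injective = proj₁ (proj₂ (proj₂ card))

  index : ∀ x → P x → Fin k
  index x p = proj₁ (proj₂ (proj₂ (proj₂ card)) x p)

  enum-index : ∀ x p → enum (index x p) ~ x
  enum-index x p = proj₂ (proj₂ (proj₂ (proj₂ card)) x p)

-- Frame-preserving automorphisms

module AutD (S : SOS) where
  open SOS S

  IsAutD-flip : ∀ π → IsAutD S π → IsAutD S (flip π)
  IsAutD-flip π (order , frames) = order⁻¹ , frames⁻¹
    where
    frames⁻¹ : ∀ x → frame (π ⟨$⟩ˡ x) ≡ frame x
    frames⁻¹ x = trans (sym (frames (π ⟨$⟩ˡ x))) (cong frame (inverseʳ π))

    order⁻¹ : ∀ x y → (x ⊑ y) ⇔ ((π ⟨$⟩ˡ x) ⊑ (π ⟨$⟩ˡ y))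
    order⁻¹ x y = mk⇔
      (λ x⊑y → Equivalence.from (order _ _)
                  (subst₂ _⊑_ (sym (inverseʳ π)) (sym (inverseʳ π)) x⊑y))
      (λ x⊑y → subst₂ _⊑_ (inverseʳ π) (inverseʳ π) (Equivalence.to (order _ _) x⊑y))

  IsAutD-⊏ : ∀ π → IsAutD S π → ∀ {x y} →
    _⊏_ S x y → _⊏_ S (π ⟨$⟩ʳ x) (π ⟨$⟩ʳ y)
  IsAutD-⊏ π (order , _) (x⊑y , x≢y) =
    Equivalence.to (order _ _) x⊑y ,
    λ πx≡πy → x≢y (trans (sym (inverseˡ π)) (trans (cong (π ⟨$⟩ˡ_) πx≡πy) (inverseˡ π)))

  IsAutD-⊏⁻¹ : ∀ π → IsAutD S π → ∀ {x y} →
    _⊏_ S x y → _⊏_ S (π ⟨$⟩ˡ x) (π ⟨$⟩ˡ y)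
  IsAutD-⊏⁻¹ π aut = IsAutD-⊏ (flip π) (IsAutD-flip π aut)

  IsUnionOfFrames : (Fin N → Set) → Set
  IsUnionOfFrames V = ∀ x y → frame x ≡ frame y → V x → V y

  Antichain-image : ∀ π {A} → IsAutD S π → Antichain S A → Antichain S (image π A)
  Antichain-image π {A} aut anti x y x∈ y∈ x⊏y =
    anti _ _ (∈-image⁻ π A x∈) (∈-image⁻ π A y∈) (IsAutD-⊏⁻¹ π aut x⊏y)

  OrderAutonomousIn-image : ∀ π {A V} → IsAutD S π → IsUnionOfFrames V →
    OrderAutonomousIn S V A → OrderAutonomousIn S V (image π A)
  OrderAutonomousIn-image π {A} {V} aut@(_ , frames) V-frames
                          ((a , a∈) , A⊆V , autonomous) =
    (π ⟨$⟩ʳ a , ∈-image π A a∈) ,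
    (λ b b∈ → V-frames _ _ (frames⁻¹ b) (A⊆V _ (∈-image⁻ π A b∈))) ,
    autonomous′
    where
    frames⁻¹ : ∀ x → frame (π ⟨$⟩ˡ x) ≡ frame x
    frames⁻¹ = proj₂ (IsAutD-flip π aut)

    moved : ∀ {x y} → _⊏_ S (π ⟨$⟩ˡ x) (π ⟨$⟩ˡ y) → _⊏_ S x y
    moved x⊏y = subst₂ (_⊏_ S) (inverseʳ π) (inverseʳ π) (IsAutD-⊏ π aut x⊏y)

    autonomous′ : ∀ z → V z → z ∉ image π A →
      ((∃[ b ] (b ∈ image π A × _⊏_ S z b)) → ∀ b → b ∈ image π A → _⊏_ S z b) ×
      ((∃[ b ] (b ∈ image π A × _⊏_ S b z)) → ∀ b → b ∈ image π A → _⊏_ S b z)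
    autonomous′ z z∈V z∉ = below , above
      where
      pulled = autonomous (π ⟨$⟩ˡ z) (V-frames _ _ (sym (frames⁻¹ z)) z∈V)
                          (λ z∈ → z∉ (∈-image⁺ π A z∈))
      below = λ { (b , b∈ , z⊏b) b′ b′∈ → moved (proj₁ pulled
        (π ⟨$⟩ˡ b , ∈-image⁻ π A b∈ , IsAutD-⊏⁻¹ π aut z⊏b) _ (∈-image⁻ π A b′∈)) }
      above = λ { (b , b∈ , b⊏z) b′ b′∈ → moved (proj₂ pulled
        (π ⟨$⟩ˡ b , ∈-image⁻ π A b∈ , IsAutD-⊏⁻¹ π aut b⊏z) _ (∈-image⁻ π A b′∈)) }

  W-isUnionOfFrames : ∀ n → IsUnionOfFrames (W S n)
  W-isUnionOfFrames n x y e = subst (_< n) e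

  MaxBlock-image : ∀ π {n j A} → IsAutD S π → MaxBlock S n j A → MaxBlock S n j (image π A)
  MaxBlock-image π {n} {j} {A} aut (A⊆Dj , autonomous , anti , maximal) =
    inFrame π aut A⊆Dj , OrderAutonomousIn-image π aut (W-isUnionOfFrames n) autonomous ,
    Antichain-image π aut anti , maximal′
    where
    inFrame : ∀ σ {B} → IsAutD S σ → (∀ b → b ∈ B → frame b ≡ j) →
      ∀ b → b ∈ image σ B → frame b ≡ j
    inFrame σ {B} aut-σ B⊆Dj b b∈ =
      trans (sym (proj₂ (IsAutD-flip σ aut-σ) b)) (B⊆Dj _ (∈-image⁻ σ B b∈))

    aut⁻¹ = IsAutD-flip π aut

    -- B ⊇ π[A] pulls back to π⁻¹[B] ⊇ A, which maximality of A bounds.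
    maximal′ : ∀ B → image π A ⊆ B → (∀ b → b ∈ B → frame b ≡ j) →
      OrderAutonomousIn S (W S n) B → Antichain S B → B ⊆ image π A
    maximal′ B πA⊆B B⊆Dj autonomous-B anti-B b∈B =
      ∈-image⁺ π A (maximal (image (flip π) B) A⊆π⁻¹B (inFrame (flip π) aut⁻¹ B⊆Dj)
        (OrderAutonomousIn-image (flip π) aut⁻¹ (W-isUnionOfFrames n) autonomous-B)
        (Antichain-image (flip π) aut⁻¹ anti-B) (∈-image (flip π) B b∈B))
      where
      A⊆π⁻¹B : A ⊆ image (flip π) B
      A⊆π⁻¹B a∈ = ∈-image⁺ (flip π) B (πA⊆B (∈-image π A a∈))

-- The restriction Φ ↦ Φ_n

module Restriction (S : SOS) (n s : ℕ) (rep : Fin (SOS.N S) → Fin (SOS.N S))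
                   (isRep : IsRepChoice S n s rep) where
  open SOS S
  open AutD S

  U : Fin N → Set
  U = Un S n s rep

  _ₙ : Permutation′ N → Fin N → Fin N
  _ₙ = restrictN S s rep

  restrict-below : ∀ π {x} → frame x < s → (π ₙ) x ≡ π ⟨$⟩ʳ x
  restrict-below π {x} x<s with frame x <? s
  ... | yes _   = refl
  ... | no  x≮s = contradiction x<s x≮s

  restrict-above : ∀ π {x} → s ≤ frame x → (π ₙ) x ≡ rep (π ⟨$⟩ʳ x)
  restrict-above π {x} s≤x with frame x <? s
  ... | yes x<s = contradiction s≤x (<⇒≱ x<s)
  ... | no  _   = refl

  restrict-cong : ∀ {π ρ} → π ≈ ρ → ∀ x → (π ₙ) x ≡ (ρ ₙ) x
  restrict-cong π≈ρ x with frame x <? s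
  ... | yes _ = π≈ρ x
  ... | no  _ = cong rep (π≈ρ x)

  InRange-frame : ∀ {x y} → frame y ≡ frame x → InRange S n s x → InRange S n s y
  InRange-frame e (s≤x , x≤n-1) = subst (s ≤_) (sym e) s≤x , subst (_≤ n ∸ 1) (sym e) x≤n-1

  rep-frame : ∀ {x} → InRange S n s x → frame (rep x) ≡ frame x
  rep-frame ir = let (A , (A⊆Dj , _) , x∈A , rx∈A) = proj₁ isRep _ ir
                 in trans (A⊆Dj _ rx∈A) (sym (A⊆Dj _ x∈A))

  rep-idempotent : ∀ {x} → InRange S n s x → rep (rep x) ≡ rep x
  rep-idempotent {x} ir = let (A , maxA , x∈A , rx∈A) = proj₁ isRep _ ir in
    proj₂ isRep (rep x) x (InRange-frame (rep-frame ir) ir) ir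
      (A , subst (λ j → MaxBlock S n j A) (sym (rep-frame ir)) maxA , rx∈A , x∈A)

  -- π maps the block of y onto a block, which then contains both π y and π (rep y).
  rep-image : ∀ π {y} → IsAutD S π → InRange S n s y →
    rep (π ⟨$⟩ʳ y) ≡ rep (π ⟨$⟩ʳ rep y)
  rep-image π {y} aut@(_ , frames) ir = let (A , maxA , y∈A , ry∈A) = proj₁ isRep _ ir in
    proj₂ isRep _ _ (InRange-frame (frames y) ir)
      (InRange-frame (trans (frames (rep y)) (rep-frame ir)) ir)
      (image π A ,
       subst (λ j → MaxBlock S n j (image π A)) (sym (frames y)) (MaxBlock-image π aut maxA) ,
       ∈-image π A y∈A , ∈-image π A ry∈A)

  restrict-preserves-U : ∀ π → IsAutD S π → ∀ {x} → U x → U ((π ₙ) x)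
  restrict-preserves-U π (_ , frames) {x} (inj₁ x<s) =
    inj₁ (subst (_< s) (sym (trans (cong frame (restrict-below π x<s)) (frames x))) x<s)
  restrict-preserves-U π (_ , frames) {x} (inj₂ (ir , _)) =
    inj₂ (InRange-frame frame-πₙx ir ,
          trans (cong rep πₙx) (trans (rep-idempotent irπ) (sym πₙx)))
    where
    πₙx = restrict-above π (proj₁ ir)
    irπ = InRange-frame (frames x) ir
    frame-πₙx : frame ((π ₙ) x) ≡ frame x
    frame-πₙx = trans (cong frame πₙx) (trans (rep-frame irπ) (frames x))

  restrict-id : ∀ {x} → U x → (Perm.id ₙ) x ≡ x
  restrict-id (inj₁ x<s)        = restrict-below Perm.id x<s
  restrict-id (inj₂ (ir , rx≡x)) = trans (restrict-above Perm.id (proj₁ ir)) rx≡x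

  restrict-∘ₚ : ∀ π ρ → IsAutD S π → IsAutD S ρ →
    ∀ {x} → U x → ((π ∘ₚ ρ) ₙ) x ≡ (ρ ₙ) ((π ₙ) x)
  restrict-∘ₚ π ρ (_ , frames) aut-ρ {x} (inj₁ x<s) = begin
    ((π ∘ₚ ρ) ₙ) x           ≡⟨ restrict-below (π ∘ₚ ρ) x<s ⟩
    ρ ⟨$⟩ʳ (π ⟨$⟩ʳ x)        ≡⟨ restrict-below ρ (subst (_< s) (sym (frames x)) x<s) ⟨
    (ρ ₙ) (π ⟨$⟩ʳ x)         ≡⟨ cong (ρ ₙ) (restrict-below π x<s) ⟨
    (ρ ₙ) ((π ₙ) x)          ∎
  restrict-∘ₚ π ρ (_ , frames) aut-ρ {x} (inj₂ (ir , _)) = begin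
    ((π ∘ₚ ρ) ₙ) x           ≡⟨ restrict-above (π ∘ₚ ρ) (proj₁ ir) ⟩
    rep (ρ ⟨$⟩ʳ (π ⟨$⟩ʳ x))  ≡⟨ rep-image ρ aut-ρ irπ ⟩
    rep (ρ ⟨$⟩ʳ rep (π ⟨$⟩ʳ x)) ≡⟨ restrict-above ρ (proj₁ (InRange-frame (rep-frame irπ) irπ)) ⟨
    (ρ ₙ) (rep (π ⟨$⟩ʳ x))   ≡⟨ cong (ρ ₙ) (restrict-above π (proj₁ ir)) ⟨
    (ρ ₙ) ((π ₙ) x)          ∎
    where irπ = InRange-frame (frames x) ir

  restrict-flip-inverseˡ : ∀ π → IsAutD S π → ∀ {x} → U x → (flip π ₙ) ((π ₙ) x) ≡ x
  restrict-flip-inverseˡ π aut {x} ux = begin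
    (flip π ₙ) ((π ₙ) x)     ≡⟨ restrict-∘ₚ π (flip π) aut (IsAutD-flip π aut) ux ⟨
    ((π ∘ₚ flip π) ₙ) x      ≡⟨ restrict-cong (λ _ → inverseˡ π) x ⟩
    (Perm.id ₙ) x            ≡⟨ restrict-id ux ⟩
    x                        ∎

  restrict-flip-inverseʳ : ∀ π → IsAutD S π → ∀ {x} → U x → (π ₙ) ((flip π ₙ) x) ≡ x
  restrict-flip-inverseʳ π aut {x} ux = begin
    (π ₙ) ((flip π ₙ) x)     ≡⟨ restrict-∘ₚ (flip π) π (IsAutD-flip π aut) aut ux ⟨
    ((flip π ∘ₚ π) ₙ) x      ≡⟨ restrict-cong (λ _ → inverseʳ π) x ⟩
    (Perm.id ₙ) x            ≡⟨ restrict-id ux ⟩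
    x                        ∎

  restrict-∘ₚ-flip≗id⇔≗ : ∀ π ρ → IsAutD S π → IsAutD S ρ →
    EqOn U ((π ∘ₚ flip ρ) ₙ) id ⇔ EqOn U (π ₙ) (ρ ₙ)
  restrict-∘ₚ-flip≗id⇔≗ π ρ aut-π aut-ρ = mk⇔
    (λ πρ⁻¹≗id x ux → begin
      (π ₙ) x                    ≡⟨ restrict-flip-inverseʳ ρ aut-ρ (restrict-preserves-U π aut-π ux) ⟨
      (ρ ₙ) ((flip ρ ₙ) ((π ₙ) x)) ≡⟨ cong (ρ ₙ) (restrict-∘ₚ π (flip ρ) aut-π aut-ρ⁻¹ ux) ⟨
      (ρ ₙ) (((π ∘ₚ flip ρ) ₙ) x)  ≡⟨ cong (ρ ₙ) (πρ⁻¹≗id x ux) ⟩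
      (ρ ₙ) x                    ∎)
    (λ π≗ρ x ux → begin
      ((π ∘ₚ flip ρ) ₙ) x        ≡⟨ restrict-∘ₚ π (flip ρ) aut-π aut-ρ⁻¹ ux ⟩
      (flip ρ ₙ) ((π ₙ) x)       ≡⟨ cong (flip ρ ₙ) (π≗ρ x ux) ⟩
      (flip ρ ₙ) ((ρ ₙ) x)       ≡⟨ restrict-flip-inverseˡ ρ aut-ρ ux ⟩
      x                          ∎)
    where aut-ρ⁻¹ = IsAutD-flip ρ aut-ρ

-- The kernel H of Φ ↦ Φ_n in a subgroup G* of Aut_D(U)

module Kernel (S : SOS) (n s : ℕ) (rep : Fin (SOS.N S) → Fin (SOS.N S))
              (isRep : IsRepChoice S n s rep)
              (G : Permutation′ (SOS.N S) → Set) (isSubgroup : IsSubgroupAutD S G) where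
  open SOS S
  open AutD S
  open Restriction S n s rep isRep

  G-resp-≈ : ∀ π ρ → π ≈ ρ → G π → G ρ
  G-resp-≈ = proj₁ isSubgroup

  G⊆AutD : ∀ π → G π → IsAutD S π
  G⊆AutD = proj₁ (proj₂ isSubgroup)

  G-id : G Perm.id
  G-id = proj₁ (proj₂ (proj₂ isSubgroup))

  G-∘ₚ : ∀ π ρ → G π → G ρ → G (π ∘ₚ ρ)
  G-∘ₚ = proj₁ (proj₂ (proj₂ (proj₂ isSubgroup)))

  G-flip : ∀ π → G π → G (flip π)
  G-flip = proj₂ (proj₂ (proj₂ (proj₂ isSubgroup)))

  H : Permutation′ N → Set
  H Ψ = G Ψ × EqOn U (Ψ ₙ) id

  H-isSubgroup : IsSubgroupAutD S H
  H-isSubgroup =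
    (λ π ρ π≈ρ (gπ , πₙ≗id) → G-resp-≈ π ρ π≈ρ gπ ,
       λ x ux → trans (sym (restrict-cong π≈ρ x)) (πₙ≗id x ux)) ,
    (λ π (gπ , _) → G⊆AutD π gπ) ,
    (G-id , λ x ux → restrict-id ux) ,
    (λ π ρ (gπ , πₙ≗id) (gρ , ρₙ≗id) → G-∘ₚ π ρ gπ gρ ,
       λ x ux → trans (restrict-∘ₚ π ρ (G⊆AutD π gπ) (G⊆AutD ρ gρ) ux)
                  (trans (cong (ρ ₙ) (πₙ≗id x ux)) (ρₙ≗id x ux))) ,
    (λ π (gπ , πₙ≗id) → G-flip π gπ ,
       λ x ux → trans (cong (flip π ₙ) (sym (πₙ≗id x ux)))
                  (restrict-flip-inverseˡ π (G⊆AutD π gπ) ux))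

  H-cosets : ∀ Φ Φ′ → G Φ → G Φ′ → H (Φ ∘ₚ flip Φ′) ⇔ EqOn U (Φ ₙ) (Φ′ ₙ)
  H-cosets Φ Φ′ gΦ gΦ′ = mk⇔
    (λ (_ , ≗id) → Equivalence.to ⇔-restrict ≗id)
    (λ ≗ → G-∘ₚ Φ (flip Φ′) gΦ (G-flip Φ′ gΦ′) , Equivalence.from ⇔-restrict ≗)
    where ⇔-restrict = restrict-∘ₚ-flip≗id⇔≗ Φ Φ′ (G⊆AutD Φ gΦ) (G⊆AutD Φ′ gΦ′)

  restrict-H-∘ₚ : ∀ Ψ Φ → H Ψ → G Φ → EqOn U ((Ψ ∘ₚ Φ) ₙ) (Φ ₙ)
  restrict-H-∘ₚ Ψ Φ (gΨ , Ψₙ≗id) gΦ x ux =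
    trans (restrict-∘ₚ Ψ Φ (G⊆AutD Ψ gΨ) (G⊆AutD Φ gΦ) ux) (cong (Φ ₙ) (Ψₙ≗id x ux))

  H-normal : ∀ Φ Ψ → G Φ → H Ψ → H (flip Φ ∘ₚ Ψ ∘ₚ Φ)
  H-normal Φ Ψ gΦ hΨ@(gΨ , _) =
    G-∘ₚ (flip Φ) (Ψ ∘ₚ Φ) (G-flip Φ gΦ) gΨΦ ,
    λ x ux → begin
      ((flip Φ ∘ₚ Ψ ∘ₚ Φ) ₙ) x        ≡⟨ restrict-∘ₚ (flip Φ) (Ψ ∘ₚ Φ) (IsAutD-flip Φ autΦ) (G⊆AutD _ gΨΦ) ux ⟩
      ((Ψ ∘ₚ Φ) ₙ) ((flip Φ ₙ) x)     ≡⟨ restrict-H-∘ₚ Ψ Φ hΨ gΦ _ (restrict-preserves-U (flip Φ) (IsAutD-flip Φ autΦ) ux) ⟩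
      (Φ ₙ) ((flip Φ ₙ) x)            ≡⟨ restrict-flip-inverseʳ Φ autΦ ux ⟩
      x                               ∎
    where
    autΦ = G⊆AutD Φ gΦ
    gΨΦ = G-∘ₚ Ψ Φ gΨ gΦ

  H-fixes-below : ∀ Ψ → H Ψ → ∀ {x} → frame x < s → Ψ ⟨$⟩ʳ x ≡ x
  H-fixes-below Ψ (_ , Ψₙ≗id) x<s = trans (sym (restrict-below Ψ x<s)) (Ψₙ≗id _ (inj₁ x<s))

  H-≈-if-≗-on-Q : ∀ Ψ Ψ′ → H Ψ → H Ψ′ → EqOn (Q S s) (Ψ ⟨$⟩ʳ_) (Ψ′ ⟨$⟩ʳ_) → Ψ ≈ Ψ′
  H-≈-if-≗-on-Q Ψ Ψ′ hΨ hΨ′ ≗Q x with frame x <? s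
  ... | yes x<s = trans (H-fixes-below Ψ hΨ x<s) (sym (H-fixes-below Ψ′ hΨ′ x<s))
  ... | no  x≮s = ≗Q x (≮⇒≥ x≮s)

  -- Φ ∈ G* is encoded as (the index of Φ_n , the index of (Φ ∘ₚ φ⁻¹)|_Q), where
  -- φ is the enumerated representative with φ_n = Φ_n; conversely (j , k)
  -- is decoded as ψ_k ∘ₚ φ_j.
  module Counting {a b c : ℕ}
    (cardG : HasCard G _≈_ a)
    (cardImage : HasCard (λ f → ∃[ Φ ] (G Φ × EqOn U f (Φ ₙ))) (EqOn U) b)
    (cardKernel : HasCard (λ f → ∃[ Ψ ] (H Ψ × EqOn (Q S s) f (Ψ ⟨$⟩ʳ_))) (EqOn (Q S s)) c)
    where
    module Gₑ = Enumeration {_~_ = _≈_} cardG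
    module Imageₑ = Enumeration {_~_ = EqOn U} cardImage
    module Kernelₑ = Enumeration {_~_ = EqOn (Q S s)} cardKernel

    φ : Fin b → Permutation′ N
    φ j = proj₁ (Imageₑ.enum-valid j)

    G-φ : ∀ j → G (φ j)
    G-φ j = proj₁ (proj₂ (Imageₑ.enum-valid j))

    enum-≗-φ : ∀ j → EqOn U (Imageₑ.enum j) (φ j ₙ)
    enum-≗-φ j = proj₂ (proj₂ (Imageₑ.enum-valid j))

    ψ : Fin c → Permutation′ N
    ψ k = proj₁ (Kernelₑ.enum-valid k)

    H-ψ : ∀ k → H (ψ k)
    H-ψ k = proj₁ (proj₂ (Kernelₑ.enum-valid k))

    enum-≗-ψ : ∀ k → EqOn (Q S s) (Kernelₑ.enum k) (ψ k ⟨$⟩ʳ_)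
    enum-≗-ψ k = proj₂ (proj₂ (Kernelₑ.enum-valid k))

    imageIndex : ∀ Φ → G Φ → Fin b
    imageIndex Φ gΦ = Imageₑ.index (Φ ₙ) (Φ , gΦ , λ _ _ → refl)

    φ-imageIndex : ∀ Φ gΦ → EqOn U (φ (imageIndex Φ gΦ) ₙ) (Φ ₙ)
    φ-imageIndex Φ gΦ x ux =
      trans (sym (enum-≗-φ _ x ux)) (Imageₑ.enum-index (Φ ₙ) (Φ , gΦ , λ _ _ → refl) x ux)

    kernelIndex : ∀ Ψ → H Ψ → Fin c
    kernelIndex Ψ hΨ = Kernelₑ.index (Ψ ⟨$⟩ʳ_) (Ψ , hΨ , λ _ _ → refl)

    kernelIndex-≈ : ∀ Ψ hΨ Ψ′ hΨ′ → kernelIndex Ψ hΨ ≡ kernelIndex Ψ′ hΨ′ → Ψ ≈ Ψ′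
    kernelIndex-≈ Ψ hΨ Ψ′ hΨ′ k≡k′ = H-≈-if-≗-on-Q Ψ Ψ′ hΨ hΨ′ λ x q → begin
      Ψ ⟨$⟩ʳ x                             ≡⟨ Kernelₑ.enum-index _ (Ψ , hΨ , _) x q ⟨
      Kernelₑ.enum (kernelIndex Ψ hΨ) x    ≡⟨ cong (λ k → Kernelₑ.enum k x) k≡k′ ⟩
      Kernelₑ.enum (kernelIndex Ψ′ hΨ′) x  ≡⟨ Kernelₑ.enum-index _ (Ψ′ , hΨ′ , _) x q ⟩
      Ψ′ ⟨$⟩ʳ x                            ∎

    cosetRep : Fin a → Permutation′ N
    cosetRep i = φ (imageIndex (Gₑ.enum i) (Gₑ.enum-valid i))

    H-enum-∘ₚ-flip-cosetRep : ∀ i → H (Gₑ.enum i ∘ₚ flip (cosetRep i))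
    H-enum-∘ₚ-flip-cosetRep i = Equivalence.from
      (H-cosets (Gₑ.enum i) _ (Gₑ.enum-valid i) (G-φ _))
      (λ x ux → sym (φ-imageIndex (Gₑ.enum i) (Gₑ.enum-valid i) x ux))

    split : Fin a → Fin b × Fin c
    split i = imageIndex (Gₑ.enum i) (Gₑ.enum-valid i) ,
              kernelIndex _ (H-enum-∘ₚ-flip-cosetRep i)

    split-injective : ∀ {i i′} → split i ≡ split i′ → i ≡ i′
    split-injective {i} {i′} split≡ = Gₑ.enum-injective i i′
      (∘ₚ-cancelʳ (Gₑ.enum i) (Gₑ.enum i′) (flip (cosetRep i))
        (subst (λ ρ → Gₑ.enum i ∘ₚ flip (cosetRep i) ≈ Gₑ.enum i′ ∘ₚ flip ρ)
          (sym (cong φ (proj₁ (,-injective split≡))))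
          (kernelIndex-≈ _ (H-enum-∘ₚ-flip-cosetRep i) _ (H-enum-∘ₚ-flip-cosetRep i′)
            (proj₂ (,-injective split≡)))))

    G-ψ∘ₚφ : ∀ j k → G (ψ k ∘ₚ φ j)
    G-ψ∘ₚφ j k = G-∘ₚ (ψ k) (φ j) (proj₁ (H-ψ k)) (G-φ j)

    join : Fin b × Fin c → Fin a
    join (j , k) = Gₑ.index (ψ k ∘ₚ φ j) (G-ψ∘ₚφ j k)

    join-injective : ∀ {p p′} → join p ≡ join p′ → p ≡ p′
    join-injective {j , k} {j′ , k′} join≡ = cong₂ _,_ j≡j′ k≡k′
      where
      ψφ≈ψφ′ : ψ k ∘ₚ φ j ≈ ψ k′ ∘ₚ φ j′
      ψφ≈ψφ′ x = begin
        (ψ k ∘ₚ φ j) ⟨$⟩ʳ x          ≡⟨ Gₑ.enum-index _ (G-ψ∘ₚφ j k) x ⟨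
        Gₑ.enum (join (j , k)) ⟨$⟩ʳ x   ≡⟨ cong (λ i → Gₑ.enum i ⟨$⟩ʳ x) join≡ ⟩
        Gₑ.enum (join (j′ , k′)) ⟨$⟩ʳ x ≡⟨ Gₑ.enum-index _ (G-ψ∘ₚφ j′ k′) x ⟩
        (ψ k′ ∘ₚ φ j′) ⟨$⟩ʳ x        ∎

      j≡j′ : j ≡ j′
      j≡j′ = Imageₑ.enum-injective j j′ λ x ux → begin
        Imageₑ.enum j x        ≡⟨ enum-≗-φ j x ux ⟩
        (φ j ₙ) x              ≡⟨ restrict-H-∘ₚ (ψ k) (φ j) (H-ψ k) (G-φ j) x ux ⟨
        ((ψ k ∘ₚ φ j) ₙ) x     ≡⟨ restrict-cong ψφ≈ψφ′ x ⟩
        ((ψ k′ ∘ₚ φ j′) ₙ) x   ≡⟨ restrict-H-∘ₚ (ψ k′) (φ j′) (H-ψ k′) (G-φ j′) x ux ⟩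
        (φ j′ ₙ) x             ≡⟨ enum-≗-φ j′ x ux ⟨
        Imageₑ.enum j′ x       ∎

      k≡k′ : k ≡ k′
      k≡k′ = Kernelₑ.enum-injective k k′ λ x q → begin
        Kernelₑ.enum k x   ≡⟨ enum-≗-ψ k x q ⟩
        ψ k ⟨$⟩ʳ x         ≡⟨ ∘ₚ-cancelʳ (ψ k) (ψ k′) (φ j)
                                (subst (λ j″ → ψ k ∘ₚ φ j ≈ ψ k′ ∘ₚ φ j″) (sym j≡j′) ψφ≈ψφ′) x ⟩
        ψ k′ ⟨$⟩ʳ x        ≡⟨ enum-≗-ψ k′ x q ⟨
        Kernelₑ.enum k′ x  ∎

    |G|≡|image|*|kernel| : a ≡ b * c
    |G|≡|image|*|kernel| = ≡-*-if-↣-both-ways (mk↣ split-injective) (mk↣ join-injective)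

theorem4p13 :
  (S : SOS) → let open SOS S in
  3 ≤ m → Tight S → InterdependentOrbitUnion S →
  (n s : ℕ) → 3 ≤ n → n ≤ m → 1 ≤ s → s ≤ n ∸ 1 →
  IsComponentBelow S n → NeighboursOf S n s →
  (rep : Fin N → Fin N) → IsRepChoice S n s rep →
  (G : Permutation′ N → Set) → IsSubgroupAutD S G →
  let Un′ = Un S n s rep
      _ₙ = restrictN S s rep
      H = λ (Ψ : Permutation′ N) → G Ψ × EqOn Un′ (Ψ ₙ) (λ x → x)
  in
  -- H is a normal subgroup of G*
  (IsSubgroupAutD S H ×
   (∀ Φ Ψ → G Φ → H Ψ → H (flip Φ ∘ₚ Ψ ∘ₚ Φ))) ×
  -- G*/H ≅ {Φ_n : Φ ∈ G*}  (ΦH = Φ'H iff Φ'⁻¹Φ ∈ H)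
  (Σ (Permutation′ N → Fin N → Fin N) λ θ →
     (∀ Φ → G Φ → ∀ x → Un′ x → Un′ (θ Φ x)) ×
     (∀ Φ → G Φ → ∃[ Φ′ ] (G Φ′ × EqOn Un′ (θ Φ) (Φ′ ₙ))) ×
     (∀ Φ′ → G Φ′ → ∃[ Φ ] (G Φ × EqOn Un′ (θ Φ) (Φ′ ₙ))) ×
     (∀ Φ Φ′ → G Φ → G Φ′ → (H (Φ ∘ₚ flip Φ′) ⇔ EqOn Un′ (θ Φ) (θ Φ′))) ×
     (∀ Φ Φ′ → G Φ → G Φ′ →
        EqOn Un′ (θ (Φ′ ∘ₚ Φ)) (λ x → θ Φ (θ Φ′ x)))) ×
  -- |G*| = |{Φ_n : Φ ∈ G*}| · |{Ψ|_Q : Ψ ∈ H}|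
  (∀ a b c →
     HasCard G _≈_ a →
     HasCard (λ f → ∃[ Φ ] (G Φ × EqOn Un′ f (Φ ₙ))) (EqOn Un′) b →
     HasCard (λ f → ∃[ Ψ ] (H Ψ × EqOn (Q S s) f (Ψ ⟨$⟩ʳ_))) (EqOn (Q S s)) c →
     a ≡ b * c)
theorem4p13 S _ _ _ n s _ _ _ _ _ _ rep isRep G isSubgroup =
  (H-isSubgroup , H-normal) ,
  (_ₙ ,
   (λ Φ gΦ x → restrict-preserves-U Φ (G⊆AutD Φ gΦ)) ,
   (λ Φ gΦ → Φ , gΦ , λ _ _ → refl) ,
   (λ Φ gΦ → Φ , gΦ , λ _ _ → refl) ,
   H-cosets ,
   (λ Φ Φ′ gΦ gΦ′ x → restrict-∘ₚ Φ′ Φ (G⊆AutD Φ′ gΦ′) (G⊆AutD Φ gΦ))) ,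
  (λ a b c cardG cardImage cardKernel → Counting.|G|≡|image|*|kernel| cardG cardImage cardKernel)
  where
  open Restriction S n s rep isRep
  open Kernel S n s rep isRep G isSubgroup
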